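{- Under the standing assumptions below, let $A\subseteq V_G$ be strongly compressed and let $B_1<B_2$ be blocks contained in the same slice $\mathrm{Slice}_G(q)$. If $B_1\not\subseteq A$ and $A\cap B_2\ne\emptyset$, then $B_1$ and $B_2$ are consecutive in $\mathrm{Slice}_G(q)$.
   Context: All graphs are finite and simple. For $G=(V,E)$, $I_G(A,B)$ is the set of edges with one end in $A$ and the other in $B$, $I_G(A)=I_G(A,A)$, $I_G(m)=\max_{|S|=m}|I_G(S)|$. A total order is a bijection $\mathcal O:V\to\{1,\dots,|V|\}$, $\mathcal O[k,l]=\mathcal O^{ -1}(\{k,\dots,l\})$; it is optimal if $|I_G(\mathcal O[1,k])|=I_G(k)$ for all $k$; $G$ is isoperimetric if it has one. $\delta_G(1)=0$, $\delta_G(m)=I_G(m)-I_G(m-1)$. Cartesian product $G_1\square\cdots\square G_d$: tuples adjacent iff they differ in exactly one coordinate, where they are adjacent. Lexicographic order on $\mathbb R^k$: $x<y$ iff for some $i$, $x_1=y_1,\dots,x_i=y_i$, $x_{i+1}<y_{i+1}$. For $\pi\in\mathfrak S_k$, $\mathcal D^{\pi,k}$ compares $(x_{\pi(1)},\dots,x_{\pi(k)})$ lexicographically; orders on $\mathbb R^k$ induce orders on products of ordered sets via rank tuples. Isoperimetric partition of isoperimetric $G$ with optimal $\mathcal O_G$: partition into consecutive intervals $\mathcal O_G[a_i,b_i]$ such that each part induces an isoperimetric subgraph with the restricted order optimal, and every $v\in\mathcal O_G[a_i,b_i]$ has exactly $\delta_G(a_i)$ neighbours in $\mathcal O_G[a_1,b_{i-1}]$.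 Starts of parts are their first vertices. Non-decreasing: each part's induced subgraph has non-decreasing $\delta$-sequence. Regular: first and last parts' induced subgraphs have equal $\delta$-sequences. Setup: $G_i$ ($1\le i\le d$) isoperimetric with fixed optimal orders $\mathcal O_{G_i}$ and isoperimetric partitions $\mathfrak P_{G_i}$; $G=G_1\square\cdots\square G_d$; $G_S=G_{i_1}\square\cdots\square G_{i_k}$ for $S=\{i_1<\dots<i_k\}$. Blocks of $G_S$: $Z_{i_1}\times\cdots\times Z_{i_k}$, $Z_{i_j}\in\mathfrak P_{G_{i_j}}$; start: tuple of starts. An order $\mathcal O$ on a product is consistent with an order $\mathcal O'$ on the subproduct over $S$ if $x<_{\mathcal O}y$ and $x_j=y_j$ for $j\notin S$ imply the same inequality of projections in $\mathcal O'$. Domination collection: each block $B$ of each $G_S$ has $\pi_B\in\mathfrak S_{|S|}$ such that the order $\mathcal D_B$ induced by $\mathcal D^{\pi_B,|S|}$ on $B$ (coordinates ranked by restrictions of $\mathcal O_{G_{i_j}}$) is optimal for the subgraph induced by $B$, and for $S_1\subset S_2$, $\mathcal D_{B_2}$ is consistent with $\mathcal D_{B_1}$ when $B_1$ consists of the factors of $B_2$ indexed by $S_1$. $\mathcal{BL}^k_{G_S}$: same block: compare by $\mathcal D_B$; different blocks: compare starts lexicographically; $\mathcal{BL}^d_G=\mathcal{BL}^d_{G_{\{1,\dots,d\}}}$. Regular domination collection: $\mathfrak P_{G_i}$ regular for $2\le i\le d-1$, and $\pi_{B_1}=\pi_{B_2}$ for $B_1$ (resp. $B_2$) the product of the first (resp.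 last) parts of $\mathfrak P_{G_2},\dots,\mathfrak P_{G_{d-1}}$. Standing assumptions: $d\ge3$; the $\mathfrak P_{G_i}$ form a regular domination collection; $\mathfrak P_{G_i}$ non-decreasing for $i\le d-1$; $\mathcal{BL}^2_{G_i\square G_j}$ optimal for all $i<j$. Compression: for nonempty proper $S$ with an order on $G_S$, and $x\in V_{G_{\overline S}}$, the section $G_S(x)$ is the set of vertices of $G$ with $\overline S$-coordinates equal to $x$, ordered via its isomorphism with $G_S$; compression replaces each $A\cap G_S(x)$ by the initial segment of $G_S(x)$ of the same size. $A$ is strongly compressed if it is unchanged by compression for every nonempty proper $S$ with respect to $\mathcal{BL}^{|S|}_{G_S}$. Geometry: blocks of $G$ are ordered by $\mathcal{BL}^d_G$ of their starts. With $s_1,s_2,\dots$ the starts of the parts of $\mathfrak P_{G_1}$ in increasing $\mathcal O_{G_1}$-order, $\mathrm{Slice}_G(q)$ is the union of all blocks whose start has first coordinate $s_q$. Blocks $B_1<B_2$ in $\mathrm{Slice}_G(q)$ are consecutive in it if no block $B_3$ of $\mathrm{Slice}_G(q)$ satisfies $B_1<B_3<B_2$. -}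

module Defs where

open import Data.Bool.Base using (Bool; true; false; _∧_; _∨_; not; if_then_else_)
open import Data.Nat.Base using (ℕ; zero; suc; _≤_; _<_; _⊔_; _∸_; _+_; _<ᵇ_; _≡ᵇ_)
open import Data.Fin.Base using (Fin; toℕ)
open import Data.List.Base
  using (List; []; _∷_; _++_; map; foldr; length; filterᵇ; zip; zipWith; concatMap; upTo; allFin; take; concat)
open import Data.List.Membership.Propositional using (_∈_)
open import Data.List.Relation.Binary.Permutation.Propositional using (_↭_)
open import Data.Product using (_×_; _,_; proj₁; proj₂; ∃)
open import Data.Unit.Base using (⊤)
open import Data.Empty using (⊥)
open import Data.Vec.Base using (lookup)
open import Data.Fin.Permutation using (Permutation′; _⟨$⟩ʳ_)
open import Data.Fin.Subset using (Subset; Nonempty; ∁; _⊆_; _∪_; ⁅_⁆) renaming (⊤ to Full)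
open import Relation.Binary.PropositionalEquality using (_≡_)
open import Relation.Nullary using (¬_)

-- Conventions:
--  * a factor graph G_i has vertex set {0,…,n-1} ⊆ ℕ (WLOG labelling);
--  * a total order on a finite vertex set is given either as a
--    duplicate-free listing (first element = position 1) or, on product
--    vertex sets, as a Bool-valued strict comparison;
--  * subsets of vertices are lists (sublists of a listing) or Bool
--    predicates;  positions/indices are 0-based internally.

countᵇ : {A : Set} → (A → Bool) → List A → ℕ
countᵇ p xs = length (filterᵇ p xs)

-- |I_G(S)| for a duplicate-free list S of vertices (unordered pairs)
I : {A : Set} → (A → A → Bool) → List A → ℕ
I adj []       = 0
I adj (x ∷ xs) = countᵇ (adj x) xs + I adj xs

sublists : {A : Set} → List A → List (List A)
sublists []       = [] ∷ []
sublists (x ∷ xs) = map (x ∷_) (sublists xs) ++ sublists xs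

Imax : {A : Set} → (A → A → Bool) → List A → ℕ → ℕ
Imax adj W m = foldr _⊔_ 0 (map (I adj) (filterᵇ (λ S → length S ≡ᵇ m) (sublists W)))

-- δ_H(m) (δ(1) = 0 ; δ(0) is unused and set to 0)
δ : {A : Set} → (A → A → Bool) → List A → ℕ → ℕ
δ adj W zero          = 0
δ adj W (suc zero)    = 0
δ adj W (suc (suc m)) = Imax adj W (suc (suc m)) ∸ Imax adj W (suc m)

δseq : {A : Set} → (A → A → Bool) → List A → List ℕ
δseq adj W = map (λ m → δ adj W (suc m)) (upTo (length W))

Optimal : {A : Set} → (A → A → Bool) → List A → Set
Optimal adj W = (k : ℕ) → k ≤ length W → I adj (take k W) ≡ Imax adj W k

rankIn : {A : Set} → (A → A → Bool) → List A → A → ℕ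
rankIn lt W y = countᵇ (λ z → lt z y) W

initSeg : {A : Set} → (A → A → Bool) → List A → ℕ → List A
initSeg lt W k = filterᵇ (λ y → rankIn lt W y <ᵇ k) W

OptimalOrd : {A : Set} → (A → A → Bool) → (A → A → Bool) → List A → Set
OptimalOrd adj lt W = (k : ℕ) → k ≤ length W → I adj (initSeg lt W k) ≡ Imax adj W k

nth : List ℕ → ℕ → ℕ
nth []       _       = 0
nth (x ∷ xs) zero    = x
nth (x ∷ xs) (suc i) = nth xs i

indexOf : ℕ → List ℕ → ℕ
indexOf v []       = 0
indexOf v (x ∷ xs) = if v ≡ᵇ x then 0 else suc (indexOf v xs)

memᵇ : ℕ → List ℕ → Bool
memᵇ v []       = false
memᵇ v (x ∷ xs) = (v ≡ᵇ x) ∨ memᵇ v xs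

partIndex : ℕ → List (List ℕ) → ℕ
partIndex v []       = 0
partIndex v (P ∷ Ps) = if memᵇ v P then 0 else suc (partIndex v Ps)

nthL : List (List ℕ) → ℕ → List ℕ
nthL []       _       = []
nthL (x ∷ xs) zero    = x
nthL (x ∷ xs) (suc i) = nthL xs i

headℕ : List ℕ → ℕ
headℕ []      = 0
headℕ (x ∷ _) = x

eqL : List ℕ → List ℕ → Bool
eqL []       []       = true
eqL (x ∷ xs) (y ∷ ys) = (x ≡ᵇ y) ∧ eqL xs ys
eqL _        _        = false

lexLt : List ℕ → List ℕ → Bool
lexLt []       _        = false
lexLt (a ∷ as) []       = false
lexLt (a ∷ as) (b ∷ bs) = (a <ᵇ b) ∨ ((a ≡ᵇ b) ∧ lexLt as bs)

record Factor : Set where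
  field
    n     : ℕ                    -- vertex set {0,…,n-1}
    adj   : ℕ → ℕ → Bool
    ord   : List ℕ               -- the fixed order O_G (listing of V)
    parts : List (List ℕ)        -- the partition 𝔓_G, parts in order
open Factor public

SimpleGraph : Factor → Set
SimpleGraph f =
  ((u v : ℕ) → u < n f → v < n f → adj f u v ≡ adj f v u) ×
  ((v : ℕ) → v < n f → adj f v v ≡ false)

IsOptimalOrder : Factor → Set
IsOptimalOrder f = (ord f ↭ upTo (n f)) × Optimal (adj f) (ord f)

data NonEmptyL : List ℕ → Set where
  ne : ∀ x xs → NonEmptyL (x ∷ xs)

record IsIsoPartition (f : Factor) : Set where
  field
    nonempty   : ∀ P → P ∈ parts f → NonEmptyL P
    intervals  : concat (parts f) ≡ ord f
    partsOpt   : ∀ P → P ∈ parts f → Optimal (adj f) P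
    neighbours : ∀ i → i < length (parts f) → ∀ v → v ∈ nthL (parts f) i →
                 countᵇ (adj f v) (concat (take i (parts f)))
                   ≡ δ (adj f) (ord f) (suc (length (concat (take i (parts f)))))

NonDecreasingP : Factor → Set
NonDecreasingP f = ∀ P → P ∈ parts f → ∀ m → 1 ≤ m → m < length P →
                   δ (adj f) P m ≤ δ (adj f) P (suc m)

RegularP : Factor → Set
RegularP f = δseq (adj f) (nthL (parts f) 0)
             ≡ δseq (adj f) (nthL (parts f) (length (parts f) ∸ 1))

pverts : List Factor → List (List ℕ)
pverts []       = [] ∷ []
pverts (f ∷ Fs) = concatMap (λ a → map (a ∷_) (pverts Fs)) (upTo (n f))

padj : List Factor → List ℕ → List ℕ → Bool
padj (f ∷ Fs) (a ∷ x) (b ∷ y) = (adj f a b ∧ eqL x y) ∨ ((a ≡ᵇ b) ∧ padj Fs x y)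
padj _        _       _       = false

rt : List Factor → List ℕ → List ℕ
rt Fs x = zipWith (λ f v → indexOf v (ord f)) Fs x

blockOf : List Factor → List ℕ → List ℕ
blockOf Fs x = zipWith (λ f v → partIndex v (parts f)) Fs x

startOf : List Factor → List ℕ → List ℕ
startOf Fs bs = zipWith (λ f b → headℕ (nthL (parts f) b)) Fs bs

ValidBlock : List Factor → List ℕ → Set
ValidBlock []       []       = ⊤
ValidBlock (f ∷ Fs) (b ∷ bs) = (b < length (parts f)) × ValidBlock Fs bs
ValidBlock _        _        = ⊥

blockVerts : List Factor → List ℕ → List (List ℕ)
blockVerts Fs bs = filterᵇ (λ x → eqL (blockOf Fs x) bs) (pverts Fs)

permute : {k : ℕ} → Permutation′ k → List ℕ → List ℕ
permute {k} π r = map (λ j → nth r (toℕ (π ⟨$⟩ʳ j))) (allFin k)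

Dlt : {k : ℕ} → List Factor → Permutation′ k → List ℕ → List ℕ → Bool
Dlt Fs π x y = lexLt (permute π (rt Fs x)) (permute π (rt Fs y))

module _ {d : ℕ} where

  idx : Subset d → List (Fin d)
  idx S = filterᵇ (λ i → lookup S i) (allFin d)

  proj : Subset d → List ℕ → List ℕ
  proj S x = map (λ i → nth x (toℕ i)) (idx S)

  restrict : Subset d → Subset d → List ℕ → List ℕ
  restrict S1 S2 x = map proj₂ (filterᵇ (λ p → lookup S1 (proj₁ p)) (zip (idx S2) x))

-- data of a domination collection: π_B for each block B of each G_S
Domination : ℕ → Set
Domination d = (S : Subset d) → List ℕ → Permutation′ (length (idx S))

module Setup {d : ℕ} (F : Fin d → Factor) (dom : Domination d) where

  Fs : Subset d → List Factor
  Fs S = map F (idx S)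

  BLlt : Subset d → List ℕ → List ℕ → Bool
  BLlt S x y =
    if eqL (blockOf (Fs S) x) (blockOf (Fs S) y)
    then Dlt (Fs S) (dom S (blockOf (Fs S) x)) x y
    else lexLt (rt (Fs S) (startOf (Fs S) (blockOf (Fs S) x)))
               (rt (Fs S) (startOf (Fs S) (blockOf (Fs S) y)))

  record IsDominationCollection : Set where
    field
      optimal : ∀ S → Nonempty S → ∀ bs → ValidBlock (Fs S) bs →
                OptimalOrd (padj (Fs S)) (Dlt (Fs S) (dom S bs)) (blockVerts (Fs S) bs)
      consistent : ∀ S1 S2 → Nonempty S1 → S1 ⊆ S2 → ∀ bs → ValidBlock (Fs S2) bs →
                   ∀ x y → x ∈ blockVerts (Fs S2) bs → y ∈ blockVerts (Fs S2) bs →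
                   Dlt (Fs S2) (dom S2 bs) x y ≡ true →
                   restrict (∁ S1) S2 x ≡ restrict (∁ S1) S2 y →
                   Dlt (Fs S1) (dom S1 (restrict S1 S2 bs))
                       (restrict S1 S2 x) (restrict S1 S2 y) ≡ true

  -- the middle index set {2,…,d-1} (1-based), i.e. {1,…,d-2} 0-based
  Smid : Subset d
  Smid = Data.Vec.Base.tabulate (λ i → (0 <ᵇ toℕ i) ∧ (suc (toℕ i) <ᵇ d))

  firstBlock lastBlock : List ℕ
  firstBlock = map (λ i → 0) (idx Smid)
  lastBlock  = map (λ i → length (parts (F i)) ∸ 1) (idx Smid)

  record StandingAssumptions : Set where
    field
      d≥3          : 3 ≤ d
      simple       : ∀ i → SimpleGraph (F i)
      isoperimetric : ∀ i → IsOptimalOrder (F i)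
      partition    : ∀ i → IsIsoPartition (F i)
      domination   : IsDominationCollection
      regularParts : ∀ i → 1 ≤ toℕ i → suc (toℕ i) < d → RegularP (F i)
      regularπ     : ∀ j → dom Smid firstBlock ⟨$⟩ʳ j ≡ dom Smid lastBlock ⟨$⟩ʳ j
      nondecreasing : ∀ i → suc (toℕ i) < d → NonDecreasingP (F i)
      bl2optimal   : ∀ (i j : Fin d) → toℕ i < toℕ j →
                     OptimalOrd (padj (Fs (⁅ i ⁆ ∪ ⁅ j ⁆))) (BLlt (⁅ i ⁆ ∪ ⁅ j ⁆))
                                (pverts (Fs (⁅ i ⁆ ∪ ⁅ j ⁆)))

  FG : List Factor
  FG = Fs Full

  VG : List (List ℕ)
  VG = pverts FG

  section : Subset d → List ℕ → List (List ℕ)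
  section S x = filterᵇ (λ v → eqL (proj (∁ S) v) x) VG

  -- A (a subset of V_G, as a predicate) is unchanged by compression
  -- w.r.t. S: every A ∩ G_S(x) equals the initial segment of G_S(x)
  -- (ordered by 𝓑𝓛_{G_S}) of size |A ∩ G_S(x)|
  CompressedWrt : Subset d → (List ℕ → Bool) → Set
  CompressedWrt S A =
    ∀ x → x ∈ pverts (Fs (∁ S)) → ∀ v → v ∈ section S x →
    A v ≡ (rankIn (λ u w → BLlt S (proj S u) (proj S w)) (section S x) v
             <ᵇ countᵇ A (section S x))

  StronglyCompressed : (List ℕ → Bool) → Set
  StronglyCompressed A = ∀ S → Nonempty S → Nonempty (∁ S) → CompressedWrt S A

  IsBlockG : List ℕ → Set
  IsBlockG bs = ValidBlock FG bs

  blockLt : List ℕ → List ℕ → Bool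
  blockLt b1 b2 = BLlt Full (startOf FG b1) (startOf FG b2)

  -- block bs lies in Slice_G(q): its start has first coordinate s_q,
  -- i.e. its first part index is q (q 0-based)
  InSlice : ℕ → List ℕ → Set
  InSlice q bs = ∃ λ rest → bs ≡ q ∷ rest

  Consecutive : ℕ → List ℕ → List ℕ → Set
  Consecutive q b1 b2 = ∀ b3 → IsBlockG b3 → InSlice q b3 →
                        ¬ (blockLt b1 b3 ≡ true × blockLt b3 b2 ≡ true)

-- Suppose a block B₃ of the slice lay strictly between B₁ and B₂, and take v ∈ B₁ ∖ A, w ∈ A ∩ B₂.
-- Blocks of a slice share their first part index, and on valid blocks the 𝓑𝓛-order of the starts is
-- the lexicographic order of the part indices, so the remaining part indices satisfy β(v) < β₃ < β(w).
-- Lexicographic interpolation changes a single coordinate k of β(v) (or of β(w)) to β₃(k) without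
-- breaking either comparison. Moving the matching coordinate of v (or w) to the start of that part
-- yields a point that agrees with w in the first coordinate and with v outside the coordinates
-- {1, k+1} (or the other way round). Compression along these two coordinate sets, both nonempty and
-- proper since d ≥ 3, carries membership in A from w to that point and on to v: a contradiction.

module Submission where

open import Defs
open import Data.Bool.Base using (Bool; true; false; T; not; if_then_else_)
open import Data.Bool.Properties using (T-≡; T-not-≡)
open import Data.Empty using (⊥-elim)
open import Data.Fin.Base using (Fin; zero; suc; toℕ)
open import Data.Fin.Properties using () renaming (_≟_ to _≟ᶠ_)
open import Data.Fin.Subset.Properties using (x∈⁅x⁆)
open import Data.Fin.Subset using (Subset; Nonempty; ∁; ⁅_⁆) renaming (⊤ to Full; ⊥ to Empty)
open import Data.List.Base using (List; []; _∷_; _++_; map; tabulate; filterᵇ; concat; length; allFin; upTo)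
open import Data.List.Membership.Propositional using (_∈_; _∉_; find; lose)
open import Data.List.Membership.Propositional.Properties
  using (∈-++⁺ʳ; ∈-++⁻; ∈-concat⁺′; ∈-upTo⁺; ∈-upTo⁻; ∈-concatMap⁺; ∈-concatMap⁻; ∈-map⁺; ∈-map⁻; ∈-filter⁺; ∈-filter⁻)
open import Data.List.Relation.Binary.Pointwise using (Pointwise; []; _∷_)
open import Data.List.Relation.Binary.Permutation.Propositional using (↭-sym; ↭⇒↭ₛ)
open import Data.List.Relation.Binary.Permutation.Propositional.Properties using (∈-resp-↭)
open import Data.List.Relation.Binary.Permutation.Setoid.Properties using (Unique-resp-↭)
open import Data.List.Relation.Unary.Unique.Propositional.Properties using (upTo⁺)
open import Data.List.Properties
  using (map-∘; map-cong; map-cong-local; map-tabulate; tabulate-cong; ∷-injective; filter-all; filter-none)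
  renaming (≡-dec to ≡ᴸ-dec)
open import Data.List.Relation.Unary.All using (All; []; _∷_)
open import Data.List.Relation.Unary.AllPairs using (_∷_)
import Data.List.Relation.Unary.All as All
open import Data.List.Relation.Unary.All.Properties using (all-filter) renaming (map⁺ to All-map⁺)
open import Data.List.Relation.Unary.Any using (here; there)
open import Data.List.Relation.Unary.Unique.Propositional using (Unique)
open import Data.Nat.Base using (ℕ; zero; suc; _<_; _≤_; _+_; _<ᵇ_; _≡ᵇ_; z≤n; s≤s)
open import Data.Nat.Properties
  using (≡ᵇ⇒≡; ≡⇒≡ᵇ; <ᵇ⇒<; <⇒<ᵇ; <-irrefl; <-trans; <-asym; <-cmp; ≤-<-trans; m≤n⇒m≤1+n; +-monoʳ-<; _≟_)
open import Data.Product using (_×_; _,_; proj₁; proj₂; ∃; Σ-syntax)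
open import Data.Sum using (_⊎_; inj₁; inj₂)
open import Data.Unit.Base using (tt)
open import Data.Vec.Base using (_∷_; lookup; here; there)
open import Data.Vec.Functional using (updateAt)
open import Data.Vec.Functional.Properties using (updateAt-updates; updateAt-minimal)
open import Data.Vec.Properties using (lookup-replicate; lookup-map; []=⇒lookup)
open import Function.Base using (_∘_; id; const)
open import Function.Bundles using (Equivalence)
open import Relation.Binary.Definitions using (tri<; tri≈; tri>)
open import Relation.Binary.PropositionalEquality
open import Relation.Binary.PropositionalEquality.Properties using (setoid)
open import Relation.Nullary using (¬_; Dec; yes; no)
open import Relation.Nullary.Decidable using (T?)

≡true⇒T : ∀ {b} → b ≡ true → T b
≡true⇒T = Equivalence.from T-≡

T⇒≡true : ∀ {b} → T b → b ≡ true
T⇒≡true = Equivalence.to T-≡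

¬T⇒≡false : ∀ {b} → ¬ T b → b ≡ false
¬T⇒≡false {false} _  = refl
¬T⇒≡false {true}  ¬t = ⊥-elim (¬t tt)

≡ᵇ-true⇒≡ : ∀ {m n} → (m ≡ᵇ n) ≡ true → m ≡ n
≡ᵇ-true⇒≡ = ≡ᵇ⇒≡ _ _ ∘ ≡true⇒T

≡ᵇ-refl : ∀ n → (n ≡ᵇ n) ≡ true
≡ᵇ-refl n = T⇒≡true (≡⇒≡ᵇ n n refl)

≢⇒≡ᵇ-false : ∀ {m n} → m ≢ n → (m ≡ᵇ n) ≡ false
≢⇒≡ᵇ-false m≢n = ¬T⇒≡false (m≢n ∘ ≡ᵇ⇒≡ _ _)

<ᵇ-true⇒< : ∀ {m n} → (m <ᵇ n) ≡ true → m < n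
<ᵇ-true⇒< = <ᵇ⇒< _ _ ∘ ≡true⇒T

<⇒<ᵇ-true : ∀ {m n} → m < n → (m <ᵇ n) ≡ true
<⇒<ᵇ-true = T⇒≡true ∘ <⇒<ᵇ

<ᵇ-irrefl : ∀ n → (n <ᵇ n) ≡ false
<ᵇ-irrefl n = ¬T⇒≡false (<-irrefl refl ∘ <ᵇ⇒< n n)

eqL-true⇒≡ : ∀ {xs ys} → eqL xs ys ≡ true → xs ≡ ys
eqL-true⇒≡ {[]}     {[]}     _ = refl
eqL-true⇒≡ {x ∷ xs} {y ∷ ys} e with x ≡ᵇ y in x≡y
... | true = cong₂ _∷_ (≡ᵇ-true⇒≡ x≡y) (eqL-true⇒≡ e)

eqL-refl : ∀ xs → eqL xs xs ≡ true
eqL-refl []       = refl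
eqL-refl (x ∷ xs) rewrite ≡ᵇ-refl x = eqL-refl xs

≢⇒eqL-false : ∀ {xs ys} → xs ≢ ys → eqL xs ys ≡ false
≢⇒eqL-false xs≢ys = ¬T⇒≡false (xs≢ys ∘ eqL-true⇒≡ ∘ T⇒≡true)

LexLt : List ℕ → List ℕ → Set
LexLt xs ys = lexLt xs ys ≡ true

lexLt-∷⁻ : ∀ a b xs ys → LexLt (a ∷ xs) (b ∷ ys) →
           a < b ⊎ (a ≡ b × LexLt xs ys)
lexLt-∷⁻ a b xs ys h with a <ᵇ b in a<b | a ≡ᵇ b in a≡b
... | true  | _    = inj₁ (<ᵇ-true⇒< a<b)
... | false | true = inj₂ (≡ᵇ-true⇒≡ a≡b , h)

lexLt-head : ∀ {a b} xs ys → a < b → LexLt (a ∷ xs) (b ∷ ys)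
lexLt-head xs ys a<b rewrite <⇒<ᵇ-true a<b = refl

lexLt-tail : ∀ {a b} xs ys → a ≡ b → LexLt xs ys → LexLt (a ∷ xs) (b ∷ ys)
lexLt-tail {a} xs ys refl h rewrite <ᵇ-irrefl a | ≡ᵇ-refl a = h

lexLt-irrefl : ∀ xs → lexLt xs xs ≡ false
lexLt-irrefl []       = refl
lexLt-irrefl (x ∷ xs) rewrite <ᵇ-irrefl x | ≡ᵇ-refl x = lexLt-irrefl xs

lexLt-trans : ∀ xs ys zs → LexLt xs ys → LexLt ys zs → LexLt xs zs
lexLt-trans (x ∷ xs) (y ∷ ys) (z ∷ zs) p q with lexLt-∷⁻ x y xs ys p | lexLt-∷⁻ y z ys zs q
... | inj₁ x<y          | inj₁ y<z          = lexLt-head xs zs (<-trans x<y y<z)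
... | inj₁ x<y          | inj₂ (refl , _)   = lexLt-head xs zs x<y
... | inj₂ (refl , _)   | inj₁ y<z          = lexLt-head xs zs y<z
... | inj₂ (refl , xs<) | inj₂ (refl , ys<) = lexLt-tail {x} xs zs refl (lexLt-trans xs ys zs xs< ys<)

lexLt-∷-tail⁻ : ∀ a xs ys → LexLt (a ∷ xs) (a ∷ ys) → LexLt xs ys
lexLt-∷-tail⁻ a xs ys h with lexLt-∷⁻ a a xs ys h
... | inj₁ a<a        = ⊥-elim (<-irrefl refl a<a)
... | inj₂ (_ , tail) = tail

lexLt⇒≢ : ∀ {xs ys} → LexLt xs ys → xs ≢ ys
lexLt⇒≢ {xs} xs<ys refl with trans (sym xs<ys) (lexLt-irrefl xs)
... | ()

_[_]≔_ : ∀ {n} → (Fin n → ℕ) → Fin n → ℕ → Fin n → ℕ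
f [ k ]≔ t = updateAt f k (const t)

lexLt-tabulate⇒< : ∀ {n} (f g : Fin n → ℕ) → LexLt (tabulate f) (tabulate g) → ∃ λ i → f i < g i
lexLt-tabulate⇒< {suc n} f g h with lexLt-∷⁻ (f zero) (g zero) (tabulate (f ∘ suc)) (tabulate (g ∘ suc)) h
... | inj₁ f0<g0       = zero , f0<g0
... | inj₂ (_ , tail<) with lexLt-tabulate⇒< (f ∘ suc) (g ∘ suc) tail<
...   | i , fi<gi = suc i , fi<gi

lexLt-interpolate : ∀ {n} (f h g : Fin n → ℕ) →
  LexLt (tabulate f) (tabulate h) → LexLt (tabulate h) (tabulate g) →
  (∃ λ k → f k < h k × LexLt (tabulate (f [ k ]≔ h k)) (tabulate g)) ⊎
  (∃ λ k → h k < g k × LexLt (tabulate f) (tabulate (g [ k ]≔ h k)))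
lexLt-interpolate {suc n} f h g f<h h<g
  with lexLt-∷⁻ (f zero) (h zero) (tabulate (f ∘ suc)) (tabulate (h ∘ suc)) f<h
     | lexLt-∷⁻ (h zero) (g zero) (tabulate (h ∘ suc)) (tabulate (g ∘ suc)) h<g
... | inj₁ f₀<h₀ | inj₁ h₀<g₀ =
  inj₁ (zero , f₀<h₀ , lexLt-head (tabulate (f ∘ suc)) (tabulate (g ∘ suc)) h₀<g₀)
... | inj₁ f₀<h₀ | inj₂ (h₀≡g₀ , h′<g′) with lexLt-tabulate⇒< (h ∘ suc) (g ∘ suc) h′<g′
...   | k , hk<gk =
  inj₂ (suc k , hk<gk , lexLt-head (tabulate (f ∘ suc)) (tabulate ((g ∘ suc) [ k ]≔ h (suc k)))
                                   (subst (f zero <_) h₀≡g₀ f₀<h₀))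
lexLt-interpolate {suc n} f h g f<h h<g | inj₂ (f₀≡h₀ , f′<h′) | inj₁ h₀<g₀
  with lexLt-tabulate⇒< (f ∘ suc) (h ∘ suc) f′<h′
...   | k , fk<hk =
  inj₁ (suc k , fk<hk , lexLt-head (tabulate ((f ∘ suc) [ k ]≔ h (suc k))) (tabulate (g ∘ suc))
                                   (subst (_< g zero) (sym f₀≡h₀) h₀<g₀))
lexLt-interpolate {suc n} f h g f<h h<g | inj₂ (f₀≡h₀ , f′<h′) | inj₂ (h₀≡g₀ , h′<g′)
  with lexLt-interpolate (f ∘ suc) (h ∘ suc) (g ∘ suc) f′<h′ h′<g′
... | inj₁ (k , fk<hk , moved<g) =
  inj₁ (suc k , fk<hk , lexLt-tail (tabulate ((f ∘ suc) [ k ]≔ h (suc k))) (tabulate (g ∘ suc))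
                                   (trans f₀≡h₀ h₀≡g₀) moved<g)
... | inj₂ (k , hk<gk , f<moved) =
  inj₂ (suc k , hk<gk , lexLt-tail (tabulate (f ∘ suc)) (tabulate ((g ∘ suc) [ k ]≔ h (suc k)))
                                   (trans f₀≡h₀ h₀≡g₀) f<moved)

memᵇ-true⇒∈ : ∀ {v xs} → memᵇ v xs ≡ true → v ∈ xs
memᵇ-true⇒∈ {v} {x ∷ xs} h with v ≡ᵇ x in v≡x
... | true  = here (≡ᵇ-true⇒≡ v≡x)
... | false = there (memᵇ-true⇒∈ h)

∈⇒memᵇ-true : ∀ {v xs} → v ∈ xs → memᵇ v xs ≡ true
∈⇒memᵇ-true {v} (here refl) rewrite ≡ᵇ-refl v = refl
∈⇒memᵇ-true {v} {x ∷ _} (there v∈xs) with v ≡ᵇ x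
... | true  = refl
... | false = ∈⇒memᵇ-true v∈xs

∉⇒memᵇ-false : ∀ {v xs} → v ∉ xs → memᵇ v xs ≡ false
∉⇒memᵇ-false v∉xs = ¬T⇒≡false (v∉xs ∘ memᵇ-true⇒∈ ∘ T⇒≡true)

Unique-++⇒disjoint : ∀ {v} (xs ys : List ℕ) → Unique (xs ++ ys) → v ∈ xs → v ∉ ys
Unique-++⇒disjoint (x ∷ xs) ys (x∉ ∷ _) (here refl) v∈ys = All.lookup x∉ (∈-++⁺ʳ xs v∈ys) refl
Unique-++⇒disjoint (x ∷ xs) ys (_ ∷ u)  (there v∈xs) = Unique-++⇒disjoint xs ys u v∈xs

Unique-++⇒Uniqueʳ : ∀ (xs : List ℕ) {ys} → Unique (xs ++ ys) → Unique ys
Unique-++⇒Uniqueʳ []       u       = u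
Unique-++⇒Uniqueʳ (x ∷ xs) (_ ∷ u) = Unique-++⇒Uniqueʳ xs u

indexOf-++ʳ : ∀ {v} xs ys → v ∉ xs → indexOf v (xs ++ ys) ≡ length xs + indexOf v ys
indexOf-++ʳ []       ys v∉ = refl
indexOf-++ʳ (x ∷ xs) ys v∉ rewrite ≢⇒≡ᵇ-false (v∉ ∘ here) =
  cong suc (indexOf-++ʳ xs ys (v∉ ∘ there))

partIndex<length : ∀ {v} Ps → v ∈ concat Ps → partIndex v Ps < length Ps
partIndex<length {v} (P ∷ Ps) v∈ with memᵇ v P in v∈P | ∈-++⁻ P v∈
... | true  | _         = s≤s z≤n
... | false | inj₂ v∈Ps = s≤s (partIndex<length Ps v∈Ps)
... | false | inj₁ v∈P′ with trans (sym v∈P) (∈⇒memᵇ-true v∈P′)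
...   | ()

PartsNonEmpty : List (List ℕ) → Set
PartsNonEmpty Ps = ∀ P → P ∈ Ps → NonEmptyL P

headℕ∈ : ∀ {P} → NonEmptyL P → headℕ P ∈ P
headℕ∈ (ne x xs) = here refl

nthL∈ : ∀ Ps {c} → c < length Ps → nthL Ps c ∈ Ps
nthL∈ (P ∷ Ps) {zero}  _         = here refl
nthL∈ (P ∷ Ps) {suc c} (s≤s c<) = there (nthL∈ Ps c<)

head-nthL∈concat : ∀ Ps {c} → PartsNonEmpty Ps → c < length Ps → headℕ (nthL Ps c) ∈ concat Ps
head-nthL∈concat Ps nonempty c< = ∈-concat⁺′ (headℕ∈ (nonempty _ (nthL∈ Ps c<))) (nthL∈ Ps c<)

later-head∉first : ∀ P Ps {c} → PartsNonEmpty (P ∷ Ps) → Unique (P ++ concat Ps) → c < length Ps →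
                   headℕ (nthL Ps c) ∉ P
later-head∉first P Ps nonempty u c< h∈P =
  Unique-++⇒disjoint P (concat Ps) u h∈P (head-nthL∈concat Ps (λ Q → nonempty Q ∘ there) c<)

partIndex-head : ∀ Ps {c} → PartsNonEmpty Ps → Unique (concat Ps) → c < length Ps →
                 partIndex (headℕ (nthL Ps c)) Ps ≡ c
partIndex-head (P ∷ Ps) {zero} nonempty u _ with nonempty P (here refl)
... | ne x xs rewrite ≡ᵇ-refl x = refl
partIndex-head (P ∷ Ps) {suc c} nonempty u (s≤s c<)
  rewrite ∉⇒memᵇ-false (later-head∉first P Ps nonempty u c<) =
  cong suc (partIndex-head Ps (λ Q → nonempty Q ∘ there) (Unique-++⇒Uniqueʳ P u) c<)

indexOf-head-< : ∀ Ps {c c′} → PartsNonEmpty Ps → Unique (concat Ps) → c < c′ → c′ < length Ps →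
                 indexOf (headℕ (nthL Ps c)) (concat Ps) < indexOf (headℕ (nthL Ps c′)) (concat Ps)
indexOf-head-< (P ∷ Ps) {zero} {suc c′} nonempty u _ (s≤s c′<)
  with nonempty P (here refl) | later-head∉first P Ps nonempty u c′<
... | ne x xs | h∉P rewrite ≡ᵇ-refl x | ≢⇒≡ᵇ-false (h∉P ∘ here) = s≤s z≤n
indexOf-head-< (P ∷ Ps) {suc c} {suc c′} nonempty u (s≤s c<c′) (s≤s c′<)
  rewrite indexOf-++ʳ P (concat Ps) (later-head∉first P Ps nonempty u (<-trans c<c′ c′<))
        | indexOf-++ʳ P (concat Ps) (later-head∉first P Ps nonempty u c′<) =
  +-monoʳ-< (length P) (indexOf-head-< Ps (λ Q → nonempty Q ∘ there) (Unique-++⇒Uniqueʳ P u) c<c′ c′<)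

partOf : Factor → ℕ → ℕ
partOf f v = partIndex v (parts f)

start : Factor → ℕ → ℕ
start f c = headℕ (nthL (parts f) c)

startRank : Factor → ℕ → ℕ
startRank f c = indexOf (start f c) (ord f)

record PartitionStarts (f : Factor) : Set where
  field
    partOf-start : ∀ {c} → c < length (parts f) → partOf f (start f c) ≡ c
    startRank-< : ∀ {c c′} → c < c′ → c′ < length (parts f) → startRank f c < startRank f c′
    start<n : ∀ {c} → c < length (parts f) → start f c < n f
    partOf<length : ∀ {v} → v < n f → partOf f v < length (parts f)

partitionStarts : ∀ f → IsOptimalOrder f → IsIsoPartition f → PartitionStarts f
partitionStarts f (ord↭ , _) iso = record
  { partOf-start  = partIndex-head (parts f) nonempty unique-parts
  ; startRank-<   = λ c<c′ c′< → subst (λ o → indexOf (start f _) o < indexOf (start f _) o) intervals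
                                   (indexOf-head-< (parts f) nonempty unique-parts c<c′ c′<)
  ; start<n       = λ c< → ∈-upTo⁻ (∈-resp-↭ ord↭
                             (subst (_ ∈_) intervals (head-nthL∈concat (parts f) nonempty c<)))
  ; partOf<length = λ v< → partIndex<length (parts f)
                             (subst (_ ∈_) (sym intervals) (∈-resp-↭ (↭-sym ord↭) (∈-upTo⁺ v<)))
  }
  where
    open IsIsoPartition iso
    unique-parts : Unique (concat (parts f))
    unique-parts = subst Unique (sym intervals)
                     (Unique-resp-↭ (setoid ℕ) (↭⇒↭ₛ (↭-sym ord↭)) (upTo⁺ (n f)))

module _ {f : Factor} (ps : PartitionStarts f) where
  open PartitionStarts ps

  startRank-<⁻ : ∀ {a b} → a < length (parts f) → b < length (parts f) →
                 startRank f a < startRank f b → a < b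
  startRank-<⁻ {a} {b} a< b< ra<rb with <-cmp a b
  ... | tri< a<b _ _ = a<b
  ... | tri≈ _ refl _ = ⊥-elim (<-irrefl refl ra<rb)
  ... | tri> _ _ b<a = ⊥-elim (<-asym ra<rb (startRank-< b<a a<))

  startRank-injective : ∀ {a b} → a < length (parts f) → b < length (parts f) →
                        startRank f a ≡ startRank f b → a ≡ b
  startRank-injective {a} {b} a< b< ra≡rb with <-cmp a b
  ... | tri< a<b _ _ = ⊥-elim (<-irrefl ra≡rb (startRank-< a<b b<))
  ... | tri≈ _ a≡b _ = a≡b
  ... | tri> _ _ b<a = ⊥-elim (<-irrefl (sym ra≡rb) (startRank-< b<a a<))

startRanks : List Factor → List ℕ → List ℕ
startRanks Fs b = rt Fs (startOf Fs b)

blockOf-startOf : ∀ {Fs b} → All PartitionStarts Fs → ValidBlock Fs b → blockOf Fs (startOf Fs b) ≡ b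
blockOf-startOf {[]}    {[]}    []         _          = refl
blockOf-startOf {_ ∷ _} {_ ∷ _} (ps ∷ pss) (c< , vb) =
  cong₂ _∷_ (PartitionStarts.partOf-start ps c<) (blockOf-startOf pss vb)

lexLt-startRanks⁺ : ∀ {Fs} b c → All PartitionStarts Fs → ValidBlock Fs c → LexLt b c →
                    LexLt (startRanks Fs b) (startRanks Fs c)
lexLt-startRanks⁺ {f ∷ Fs} (x ∷ b) (y ∷ c) (ps ∷ pss) (y< , vc) b<c with lexLt-∷⁻ x y b c b<c
... | inj₁ x<y        = lexLt-head (startRanks Fs b) (startRanks Fs c) (PartitionStarts.startRank-< ps x<y y<)
... | inj₂ (refl , b′<c′) =
  lexLt-tail {startRank f x} (startRanks Fs b) (startRanks Fs c) refl (lexLt-startRanks⁺ b c pss vc b′<c′)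

lexLt-startRanks⁻ : ∀ {Fs} b c → All PartitionStarts Fs → ValidBlock Fs b → ValidBlock Fs c →
                    LexLt (startRanks Fs b) (startRanks Fs c) → LexLt b c
lexLt-startRanks⁻ {f ∷ Fs} (x ∷ b) (y ∷ c) (ps ∷ pss) (x< , vb) (y< , vc) h
  with lexLt-∷⁻ (startRank f x) (startRank f y) (startRanks Fs b) (startRanks Fs c) h
... | inj₁ rx<ry = lexLt-head b c (startRank-<⁻ ps x< y< rx<ry)
... | inj₂ (rx≡ry , h′) =
  lexLt-tail b c (startRank-injective ps x< y< rx≡ry) (lexLt-startRanks⁻ b c pss vb vc h′)

_≟ᴸ_ : (xs ys : List ℕ) → Dec (xs ≡ ys)
_≟ᴸ_ = ≡ᴸ-dec _≟_

Transitiveᵇ : {A : Set} → (A → A → Bool) → Set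
Transitiveᵇ R = ∀ x y z → R x y ≡ true → R y z ≡ true → R x z ≡ true

Irreflexiveᵇ : {A : Set} → (A → A → Bool) → Set
Irreflexiveᵇ R = ∀ x → R x x ≡ false

module BlockOrder {A : Set} (key : A → List ℕ)
                  (inner : List ℕ → A → A → Bool) (outer : List ℕ → List ℕ → Bool) where

  _≺_ : A → A → Bool
  x ≺ y = if eqL (key x) (key y) then inner (key x) x y else outer (key x) (key y)

  ≺-same : ∀ {x y} → key x ≡ key y → x ≺ y ≡ inner (key x) x y
  ≺-same {x} {y} kx≡ky rewrite kx≡ky | eqL-refl (key y) = refl

  ≺-diff : ∀ {x y} → key x ≢ key y → x ≺ y ≡ outer (key x) (key y)
  ≺-diff kx≢ky rewrite ≢⇒eqL-false kx≢ky = refl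

  ≺-irrefl : (∀ k → Irreflexiveᵇ (inner k)) → Irreflexiveᵇ _≺_
  ≺-irrefl inner-irrefl x = trans (≺-same refl) (inner-irrefl (key x) x)

  ≺⇒inner : ∀ {x y} → key x ≡ key y → x ≺ y ≡ true → inner (key x) x y ≡ true
  ≺⇒inner kx≡ky = trans (sym (≺-same kx≡ky))

  ≺⇒outer : ∀ {x y} → key x ≢ key y → x ≺ y ≡ true → outer (key x) (key y) ≡ true
  ≺⇒outer kx≢ky = trans (sym (≺-diff kx≢ky))

  ≺-trans : (∀ k → Transitiveᵇ (inner k)) → Transitiveᵇ outer → Irreflexiveᵇ outer →
            Transitiveᵇ _≺_
  ≺-trans inner-trans outer-trans outer-irrefl x y z x≺y y≺z with key x ≟ᴸ key y | key y ≟ᴸ key z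
  ... | yes kx≡ky | yes ky≡kz =
    trans (≺-same (trans kx≡ky ky≡kz))
          (inner-trans (key x) x y z (≺⇒inner kx≡ky x≺y)
                       (subst (λ k → inner k y z ≡ true) (sym kx≡ky) (≺⇒inner ky≡kz y≺z)))
  ... | yes kx≡ky | no ky≢kz =
    trans (≺-diff (ky≢kz ∘ trans (sym kx≡ky)))
          (subst (λ k → outer k (key z) ≡ true) (sym kx≡ky) (≺⇒outer ky≢kz y≺z))
  ... | no kx≢ky | yes ky≡kz =
    trans (≺-diff (λ kx≡kz → kx≢ky (trans kx≡kz (sym ky≡kz))))
          (subst (λ k → outer (key x) k ≡ true) ky≡kz (≺⇒outer kx≢ky x≺y))
  ... | no kx≢ky | no ky≢kz with key x ≟ᴸ key z
  ...   | no kx≢kz =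
    trans (≺-diff kx≢kz) (outer-trans _ _ _ (≺⇒outer kx≢ky x≺y) (≺⇒outer ky≢kz y≺z))
  ...   | yes kx≡kz
    with trans (sym (outer-irrefl (key x)))
               (outer-trans _ _ _ (≺⇒outer kx≢ky x≺y)
                            (subst (λ k → outer (key y) k ≡ true) (sym kx≡kz) (≺⇒outer ky≢kz y≺z)))
  ...     | ()

countᵇ-mono : ∀ {A : Set} {p q : A → Bool} xs → (∀ x → p x ≡ true → q x ≡ true) →
              countᵇ p xs ≤ countᵇ q xs
countᵇ-mono [] _ = z≤n
countᵇ-mono {p = p} {q} (x ∷ xs) p⇒q with p x in px | q x in qx
... | true  | true  = s≤s (countᵇ-mono xs p⇒q)
... | false | true  = m≤n⇒m≤1+n (countᵇ-mono xs p⇒q)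
... | false | false = countᵇ-mono xs p⇒q
... | true  | false with trans (sym (p⇒q x px)) qx
...   | ()

nth-tabulate : ∀ {m} (f : Fin m → ℕ) i → nth (tabulate f) (toℕ i) ≡ f i
nth-tabulate f zero    = refl
nth-tabulate f (suc i) = nth-tabulate (f ∘ suc) i

Pointwise-tabulate⁻ : ∀ {m} {R : Factor → ℕ → Set} (F : Fin m → Factor) xs →
                      Pointwise R (tabulate F) xs →
                      xs ≡ tabulate (λ (i : Fin m) → nth xs (toℕ i)) × (∀ i → R (F i) (nth xs (toℕ i)))
Pointwise-tabulate⁻ {zero}  F []       []         = refl , λ ()
Pointwise-tabulate⁻ {suc m} F (x ∷ xs) (r ∷ rs) with Pointwise-tabulate⁻ (F ∘ suc) xs rs
... | xs≡ , rs′ = cong (x ∷_) xs≡ , λ { zero → r ; (suc i) → rs′ i }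

∈pverts⇒Pointwise : ∀ Fs {x} → x ∈ pverts Fs → Pointwise (λ f a → a < n f) Fs x
∈pverts⇒Pointwise []       (here refl) = []
∈pverts⇒Pointwise (f ∷ Fs) x∈
  with find (∈-concatMap⁻ (λ a → map (a ∷_) (pverts Fs)) {xs = upTo (n f)} x∈)
... | a , a∈ , x∈′ with ∈-map⁻ (a ∷_) x∈′
...   | y , y∈ , refl = ∈-upTo⁻ a∈ ∷ ∈pverts⇒Pointwise Fs y∈

ValidBlock⇒Pointwise : ∀ Fs {b} → ValidBlock Fs b → Pointwise (λ f c → c < length (parts f)) Fs b
ValidBlock⇒Pointwise []       {[]}    _          = []
ValidBlock⇒Pointwise (f ∷ Fs) {_ ∷ _} (c< , vb) = c< ∷ ValidBlock⇒Pointwise Fs vb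

map∈pverts : ∀ {m} (F : Fin m → Factor) (g : Fin m → ℕ) L → (∀ i → g i < n (F i)) →
             map g L ∈ pverts (map F L)
map∈pverts F g []      _ = here refl
map∈pverts F g (i ∷ L) g< =
  ∈-concatMap⁺ (λ a → map (a ∷_) (pverts (map F L))) {xs = upTo (n (F i))}
               (lose (∈-upTo⁺ (g< i)) (∈-map⁺ (g i ∷_) (map∈pverts F g L g<)))

mapValidBlock : ∀ {m} (F : Fin m → Factor) (g : Fin m → ℕ) L → (∀ i → g i < length (parts (F i))) →
                ValidBlock (map F L) (map g L)
mapValidBlock F g []      _  = tt
mapValidBlock F g (i ∷ L) g< = g< i , mapValidBlock F g L g<

filterᵇ-map : ∀ {A B : Set} (p : B → Bool) (f : A → B) xs →
              filterᵇ p (map f xs) ≡ map f (filterᵇ (p ∘ f) xs)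
filterᵇ-map p f []       = refl
filterᵇ-map p f (x ∷ xs) with p (f x)
... | true  = cong (f x ∷_) (filterᵇ-map p f xs)
... | false = filterᵇ-map p f xs

idx-tail : ∀ {m} b (S : Subset m) → filterᵇ (lookup (b ∷ S)) (tabulate suc) ≡ map suc (idx S)
idx-tail {m} b S = trans (cong (filterᵇ (lookup (b ∷ S))) (sym (map-tabulate id suc)))
                         (filterᵇ-map (lookup (b ∷ S)) suc (allFin m))

idx-Full : ∀ {m} → idx (Full {m}) ≡ allFin m
idx-Full {m} = filter-all (T? ∘ lookup Full)
                          (All.universal (λ i → ≡true⇒T (lookup-replicate i true)) (allFin m))

idx-Empty : ∀ {m} → idx (Empty {m}) ≡ []
idx-Empty {m} = filter-none (T? ∘ lookup Empty)
                  (All.universal (λ i → subst T (lookup-replicate i false)) (allFin m))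

idx-⁅⁆ : ∀ {m} (k : Fin m) → idx ⁅ k ⁆ ≡ k ∷ []
idx-⁅⁆ zero    = cong (zero ∷_) (trans (idx-tail true Empty) (cong (map suc) idx-Empty))
idx-⁅⁆ (suc k) = trans (idx-tail false ⁅ k ⁆) (cong (map suc) (idx-⁅⁆ k))

tailSet : ∀ {m} → Subset (suc m)
tailSet = false ∷ Full

pairSet : ∀ {m} → Fin m → Subset (suc m)
pairSet k = true ∷ ⁅ k ⁆

idx-tailSet : ∀ {m} → idx (tailSet {m}) ≡ map suc (allFin m)
idx-tailSet = trans (idx-tail false Full) (cong (map suc) idx-Full)

idx-pairSet : ∀ {m} (k : Fin m) → idx (pairSet k) ≡ zero ∷ suc k ∷ []
idx-pairSet k = cong (zero ∷_) (trans (idx-tail true ⁅ k ⁆) (cong (map suc) (idx-⁅⁆ k)))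

tailSet-nonempty : ∀ {m} → Nonempty (tailSet {suc m})
tailSet-nonempty = suc zero , there here

∁tailSet-nonempty : ∀ {m} → Nonempty (∁ (tailSet {m}))
∁tailSet-nonempty = zero , here

pairSet-nonempty : ∀ {m} (k : Fin m) → Nonempty (pairSet k)
pairSet-nonempty k = zero , here

∁pairSet-nonempty : ∀ {m} (k : Fin (suc (suc m))) → Nonempty (∁ (pairSet k))
∁pairSet-nonempty zero    = suc (suc zero) , there (there here)
∁pairSet-nonempty (suc k) = suc zero , there here

AgreeOutside : ∀ {m} → Subset m → (Fin m → ℕ) → (Fin m → ℕ) → Set
AgreeOutside S x y = ∀ i → lookup S i ≡ false → x i ≡ y i

agreeOutside-tailSet : ∀ {m} {x y : Fin (suc m) → ℕ} → x zero ≡ y zero → AgreeOutside tailSet x y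
agreeOutside-tailSet x₀≡y₀ zero    _       = x₀≡y₀
agreeOutside-tailSet x₀≡y₀ (suc i) outside with trans (sym outside) (lookup-replicate i true)
... | ()

agreeOutside-pairSet : ∀ {m} {k : Fin m} {x y : Fin (suc m) → ℕ} →
                       (∀ j → j ≢ k → x (suc j) ≡ y (suc j)) → AgreeOutside (pairSet k) x y
agreeOutside-pairSet {k = k} agree (suc j) outside with j ≟ᶠ k
... | no j≢k   = agree j j≢k
... | yes refl with trans (sym outside) ([]=⇒lookup (x∈⁅x⁆ k))
...   | ()

module Product {d : ℕ} (F : Fin d → Factor) (dom : Domination d) (starts : ∀ i → PartitionStarts (F i)) where
  open Setup F dom

  Point : Set
  Point = Fin d → ℕ

  InBox : Point → Set
  InBox x = ∀ i → x i < n (F i)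

  block : Point → Fin d → ℕ
  block x i = partOf (F i) (x i)

  blockOn : Subset d → Point → List ℕ
  blockOn S x = map (block x) (idx S)

  block-valid : ∀ {x} → InBox x → ∀ i → block x i < length (parts (F i))
  block-valid x∈ i = PartitionStarts.partOf<length (starts i) (x∈ i)

  allStarts : ∀ S → All PartitionStarts (Fs S)
  allStarts S = All-map⁺ (All.universal starts (idx S))

  tabulate≡map-idx-Full : ∀ {B : Set} (g : Fin d → B) → tabulate g ≡ map g (idx Full)
  tabulate≡map-idx-Full g = trans (sym (map-tabulate id g)) (cong (map g) (sym idx-Full))

  proj-tabulate : ∀ S (x : Point) → proj S (tabulate x) ≡ map x (idx S)
  proj-tabulate S x = map-cong (nth-tabulate x) (idx S)

  blockOf-map : ∀ (x : Point) L → blockOf (map F L) (map x L) ≡ map (block x) L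
  blockOf-map x []      = refl
  blockOf-map x (i ∷ L) = cong (block x i ∷_) (blockOf-map x L)

  blockOf-proj : ∀ S (x : Point) → blockOf (Fs S) (proj S (tabulate x)) ≡ blockOn S x
  blockOf-proj S x = trans (cong (blockOf (Fs S)) (proj-tabulate S x)) (blockOf-map x (idx S))

  tabulate∈VG : ∀ {x} → InBox x → tabulate x ∈ VG
  tabulate∈VG {x} x∈ = subst (_∈ VG) (sym (tabulate≡map-idx-Full x)) (map∈pverts F x (idx Full) x∈)

  VG⇒tabulate : ∀ {v} → v ∈ VG → Σ[ x ∈ Point ] InBox x × v ≡ tabulate x
  VG⇒tabulate {v} v∈ with Pointwise-tabulate⁻ F v
       (subst (λ Gs → Pointwise (λ f a → a < n f) Gs v) (sym (tabulate≡map-idx-Full F))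
              (∈pverts⇒Pointwise FG v∈))
  ... | v≡ , v∈box = _ , v∈box , v≡

  -- BLlt S unfolds definitionally to BL._≺_ S.
  module BL (S : Subset d) =
    BlockOrder (blockOf (Fs S)) (λ c → Dlt (Fs S) (dom S c))
               (λ c c′ → lexLt (startRanks (Fs S) c) (startRanks (Fs S) c′))

  BLlt-irrefl : ∀ S → Irreflexiveᵇ (BLlt S)
  BLlt-irrefl S = BL.≺-irrefl S (λ c x → lexLt-irrefl (ranked c x))
    where ranked = λ c x → permute (dom S c) (rt (Fs S) x)

  BLlt-trans : ∀ S → Transitiveᵇ (BLlt S)
  BLlt-trans S = BL.≺-trans S (λ c x y z → lexLt-trans (ranked c x) (ranked c y) (ranked c z))
                               (λ b c e → lexLt-trans (startRanks (Fs S) b) (startRanks (Fs S) c)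
                                                      (startRanks (Fs S) e))
                               (λ b → lexLt-irrefl (startRanks (Fs S) b))
    where ranked = λ c x → permute (dom S c) (rt (Fs S) x)

  BLlt-tabulate : ∀ S {x y} → InBox y → LexLt (blockOn S x) (blockOn S y) →
                  BLlt S (proj S (tabulate x)) (proj S (tabulate y)) ≡ true
  BLlt-tabulate S {x} {y} y∈ bx<by =
    trans (BL.≺-diff S (λ same → lexLt⇒≢ bx<by
                          (trans (sym (blockOf-proj S x)) (trans same (blockOf-proj S y)))))
          (subst₂ (λ b c → LexLt (startRanks (Fs S) b) (startRanks (Fs S) c))
                  (sym (blockOf-proj S x)) (sym (blockOf-proj S y))
                  (lexLt-startRanks⁺ (blockOn S x) (blockOn S y) (allStarts S)
                                     (mapValidBlock F (block y) (idx S) (block-valid y∈)) bx<by))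

  compressed-downward : ∀ {S A} → CompressedWrt S A → ∀ {c u w} → c ∈ pverts (Fs (∁ S)) →
                        u ∈ section S c → w ∈ section S c →
                        BLlt S (proj S u) (proj S w) ≡ true → A w ≡ true → A u ≡ true
  compressed-downward {S} {A} compressed {c} {u} {w} c∈ u∈ w∈ u<w Aw =
    trans (compressed c c∈ u u∈) (<⇒<ᵇ-true (≤-<-trans rank-u≤rank-w rank-w<count))
    where
      _≺_ : List ℕ → List ℕ → Bool
      a ≺ b = BLlt S (proj S a) (proj S b)
      rank-u≤rank-w : rankIn _≺_ (section S c) u ≤ rankIn _≺_ (section S c) w
      rank-u≤rank-w = countᵇ-mono (section S c) (λ z z<u → BLlt-trans S _ _ _ z<u u<w)
      rank-w<count : rankIn _≺_ (section S c) w < countᵇ A (section S c)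
      rank-w<count  = <ᵇ-true⇒< (trans (sym (compressed c c∈ w w∈)) Aw)

  proj-∁-agree : ∀ S {x y} → AgreeOutside S x y → proj (∁ S) (tabulate x) ≡ proj (∁ S) (tabulate y)
  proj-∁-agree S {x} {y} agree =
    trans (proj-tabulate (∁ S) x)
          (trans (map-cong-local (All.map (λ {i} → agree i ∘ outside i)
                                          (all-filter (T? ∘ lookup (∁ S)) (allFin d))))
                 (sym (proj-tabulate (∁ S) y)))
    where
      outside : ∀ i → T (lookup (∁ S) i) → lookup S i ≡ false
      outside i = Equivalence.to T-not-≡ ∘ subst T (lookup-map i not S)

  section-tabulate : ∀ S {x y} → InBox x → AgreeOutside S x y →
                     tabulate x ∈ section S (proj (∁ S) (tabulate y))
  section-tabulate S {x} {y} x∈ agree =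
    ∈-filter⁺ (T? ∘ _) (tabulate∈VG x∈)
              (≡true⇒T (subst (λ c → eqL c ȳ ≡ true) (sym (proj-∁-agree S agree)) (eqL-refl ȳ)))
    where ȳ = proj (∁ S) (tabulate y)

  compressed-step : ∀ {S A x y} → CompressedWrt S A → InBox x → InBox y → AgreeOutside S x y →
                    LexLt (blockOn S x) (blockOn S y) → A (tabulate y) ≡ true → A (tabulate x) ≡ true
  compressed-step {S} {A} {x} {y} compressed x∈ y∈ agree bx<by Ay =
    compressed-downward compressed
      (subst (_∈ pverts (Fs (∁ S))) (sym (proj-tabulate (∁ S) y)) (map∈pverts F y (idx (∁ S)) y∈))
      (section-tabulate S x∈ agree) (section-tabulate S {y} {y} y∈ (λ _ _ → refl))
      (BLlt-tabulate S y∈ bx<by) Ay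

  blockLt⇒lexLt : ∀ {b c} → IsBlockG b → IsBlockG c → blockLt b c ≡ true → LexLt b c
  blockLt⇒lexLt {b} {c} vb vc b<c with b ≟ᴸ c
  ... | no b≢c =
    lexLt-startRanks⁻ b c (allStarts Full) vb vc
      (subst₂ (λ b′ c′ → LexLt (startRanks FG b′) (startRanks FG c′)) block-b block-c
              (trans (sym (BL.≺-diff Full (λ same → b≢c (trans (sym block-b) (trans same block-c))))) b<c))
    where
      block-b = blockOf-startOf (allStarts Full) vb
      block-c = blockOf-startOf (allStarts Full) vc
  ... | yes refl with trans (sym b<c) (BLlt-irrefl Full (startOf FG b))
  ...   | ()

  blockOf-tabulate : ∀ x → blockOf FG (tabulate x) ≡ tabulate (block x)
  blockOf-tabulate x = begin
    blockOf FG (tabulate x)        ≡⟨ cong (blockOf FG) (tabulate≡map-idx-Full x) ⟩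
    blockOf FG (map x (idx Full))  ≡⟨ blockOf-map x (idx Full) ⟩
    map (block x) (idx Full)       ≡⟨ sym (tabulate≡map-idx-Full (block x)) ⟩
    tabulate (block x)             ∎
    where open ≡-Reasoning

  blockVerts⇒tabulate : ∀ {b v} → v ∈ blockVerts FG b →
                        Σ[ x ∈ Point ] InBox x × v ≡ tabulate x × tabulate (block x) ≡ b
  blockVerts⇒tabulate {b} v∈ with ∈-filter⁻ (T? ∘ (λ y → eqL (blockOf FG y) b)) {xs = VG} v∈
  ... | v∈VG , same-block with VG⇒tabulate v∈VG
  ...   | x , x∈ , refl =
    x , x∈ , refl , trans (sym (blockOf-tabulate x)) (eqL-true⇒≡ (T⇒≡true same-block))

  ValidBlock⇒tabulate : ∀ {b} → IsBlockG b →
                        Σ[ β ∈ Point ] (∀ i → β i < length (parts (F i))) × b ≡ tabulate β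
  ValidBlock⇒tabulate {b} vb with Pointwise-tabulate⁻ F b
       (subst (λ Gs → Pointwise (λ f c → c < length (parts f)) Gs b) (sym (tabulate≡map-idx-Full F))
              (ValidBlock⇒Pointwise FG vb))
  ... | b≡ , β< = _ , β< , b≡

module Slice {e : ℕ} (F : Fin (suc (suc (suc e))) → Factor) (dom : Domination (suc (suc (suc e))))
             (starts : ∀ i → PartitionStarts (F i)) where
  open Setup F dom
  open Product F dom starts

  blockOn-tailSet : ∀ x → blockOn tailSet x ≡ tabulate (block x ∘ suc)
  blockOn-tailSet x = begin
    map (block x) (idx tailSet)              ≡⟨ cong (map (block x)) idx-tailSet ⟩
    map (block x) (map suc (allFin _))       ≡⟨ sym (map-∘ (allFin _)) ⟩
    map (block x ∘ suc) (allFin _)           ≡⟨ map-tabulate id (block x ∘ suc) ⟩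
    tabulate (block x ∘ suc)                 ∎
    where open ≡-Reasoning

  blockOn-pairSet : ∀ x k → blockOn (pairSet k) x ≡ block x zero ∷ block x (suc k) ∷ []
  blockOn-pairSet x k = cong (map (block x)) (idx-pairSet k)

  graft : ℕ → Point → Fin (suc (suc e)) → ℕ → Point
  graft a z k c = (z [ suc k ]≔ start (F (suc k)) c) [ zero ]≔ a

  module _ (a : ℕ) (z : Point) (k : Fin (suc (suc e))) {c : ℕ} (c< : c < length (parts (F (suc k)))) where

    graft-block-at : block (graft a z k c) (suc k) ≡ c
    graft-block-at = trans (cong (partOf (F (suc k))) (updateAt-updates k (z ∘ suc)))
                           (PartitionStarts.partOf-start (starts (suc k)) c<)

    graft-InBox : a < n (F zero) → InBox z → InBox (graft a z k c)
    graft-InBox a< z∈ zero    = a<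
    graft-InBox a< z∈ (suc j) with j ≟ᶠ k
    ... | yes refl = subst (_< n (F (suc k))) (sym (updateAt-updates k (z ∘ suc)))
                           (PartitionStarts.start<n (starts (suc k)) c<)
    ... | no j≢k   = subst (_< n (F (suc j))) (sym (updateAt-minimal j k (z ∘ suc) j≢k)) (z∈ (suc j))

    graft-tail-blocks : tabulate (block (graft a z k c) ∘ suc) ≡ tabulate ((block z ∘ suc) [ k ]≔ c)
    graft-tail-blocks = tabulate-cong same
      where
        same : ∀ j → block (graft a z k c) (suc j) ≡ ((block z ∘ suc) [ k ]≔ c) j
        same j with j ≟ᶠ k
        ... | yes refl = trans graft-block-at (sym (updateAt-updates k (block z ∘ suc)))
        ... | no j≢k   = trans (cong (partOf (F (suc j))) (updateAt-minimal j k (z ∘ suc) j≢k))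
                               (sym (updateAt-minimal j k (block z ∘ suc) j≢k))

    graft-pair-blocks : blockOn (pairSet k) (graft a z k c) ≡ partOf (F zero) a ∷ c ∷ []
    graft-pair-blocks =
      trans (blockOn-pairSet (graft a z k c) k) (cong (λ b → partOf (F zero) a ∷ b ∷ []) graft-block-at)

    graft-agree : AgreeOutside (pairSet k) (graft a z k c) z
    graft-agree = agreeOutside-pairSet (λ j j≢k → updateAt-minimal j k (z ∘ suc) j≢k)

  module _ {A : List ℕ → Bool} (compressed : StronglyCompressed A) where

    tail-step : ∀ {x y} → InBox x → InBox y → x zero ≡ y zero →
                LexLt (tabulate (block x ∘ suc)) (tabulate (block y ∘ suc)) →
                A (tabulate y) ≡ true → A (tabulate x) ≡ true
    tail-step {x} {y} x∈ y∈ x₀≡y₀ x<y =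
      compressed-step {tailSet} {A} {x} {y} (compressed tailSet tailSet-nonempty ∁tailSet-nonempty)
        x∈ y∈ (agreeOutside-tailSet x₀≡y₀)
        (subst₂ LexLt (sym (blockOn-tailSet x)) (sym (blockOn-tailSet y)) x<y)

    pair-step : ∀ k {x y} → InBox x → InBox y → AgreeOutside (pairSet k) x y →
                LexLt (blockOn (pairSet k) x) (blockOn (pairSet k) y) →
                A (tabulate y) ≡ true → A (tabulate x) ≡ true
    pair-step k {x} {y} =
      compressed-step {pairSet k} {A} {x} {y} (compressed (pairSet k) (pairSet-nonempty k) (∁pairSet-nonempty k))

    across-intermediate-block : ∀ {v w β} → InBox v → InBox w → block v zero ≡ block w zero →
      (∀ j → β j < length (parts (F (suc j)))) →
      LexLt (tabulate (block v ∘ suc)) (tabulate β) → LexLt (tabulate β) (tabulate (block w ∘ suc)) →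
      A (tabulate w) ≡ true → A (tabulate v) ≡ true
    across-intermediate-block {v} {w} {β} v∈ w∈ same-slice β< v<β β<w Aw
      with lexLt-interpolate (block v ∘ suc) β (block w ∘ suc) v<β β<w
    ... | inj₁ (k , vk<βk , moved<w) = pair-step k v∈ x∈ v≈x v<x (tail-step x∈ w∈ refl x<w Aw)
      where
        x = graft (w zero) v k (β k)
        x∈ = graft-InBox (w zero) v k (β< k) (w∈ zero) v∈
        v≈x : AgreeOutside (pairSet k) v x
        v≈x i outside = sym (graft-agree (w zero) v k (β< k) i outside)
        x<w : LexLt (tabulate (block x ∘ suc)) (tabulate (block w ∘ suc))
        x<w = subst (λ b → LexLt b (tabulate (block w ∘ suc)))
                    (sym (graft-tail-blocks (w zero) v k (β< k))) moved<w
        v<x : LexLt (blockOn (pairSet k) v) (blockOn (pairSet k) x)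
        v<x = subst₂ LexLt (sym (blockOn-pairSet v k)) (sym (graft-pair-blocks (w zero) v k (β< k)))
                     (lexLt-tail (block v (suc k) ∷ []) (β k ∷ []) same-slice (lexLt-head [] [] vk<βk))
    ... | inj₂ (k , βk<wk , v<moved) = tail-step v∈ y∈ refl v<y (pair-step k y∈ w∈ y≈w y<w Aw)
      where
        y = graft (v zero) w k (β k)
        y∈ = graft-InBox (v zero) w k (β< k) (v∈ zero) w∈
        y≈w : AgreeOutside (pairSet k) y w
        y≈w = graft-agree (v zero) w k (β< k)
        v<y : LexLt (tabulate (block v ∘ suc)) (tabulate (block y ∘ suc))
        v<y = subst (LexLt (tabulate (block v ∘ suc))) (sym (graft-tail-blocks (v zero) w k (β< k))) v<moved
        y<w : LexLt (blockOn (pairSet k) y) (blockOn (pairSet k) w)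
        y<w = subst₂ LexLt (sym (graft-pair-blocks (v zero) w k (β< k))) (sym (blockOn-pairSet w k))
                     (lexLt-tail (β k ∷ []) (block w (suc k) ∷ []) same-slice (lexLt-head [] [] βk<wk))

    consecutive : ∀ q {c₁ c₂} → IsBlockG (q ∷ c₁) → IsBlockG (q ∷ c₂) →
                  (∃ λ v → v ∈ blockVerts FG (q ∷ c₁) × A v ≡ false) →
                  (∃ λ w → w ∈ blockVerts FG (q ∷ c₂) × A w ≡ true) →
                  Consecutive q (q ∷ c₁) (q ∷ c₂)
    consecutive q {c₁} {c₂} vb₁ vb₂ (v , v∈ , Av) (w , w∈ , Aw)
                .(q ∷ c₃) vb₃ (c₃ , refl) (b₁<b₃ , b₃<b₂)
      with blockVerts⇒tabulate v∈ | blockVerts⇒tabulate w∈ | ValidBlock⇒tabulate vb₃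
    ... | x , x∈ , refl , x-block | y , y∈ , refl , y-block | β , β< , b₃≡β
      with trans (sym Av) (across-intermediate-block x∈ y∈ same-slice (β< ∘ suc) x<β β<y Aw)
      where
        x-tail = proj₂ (∷-injective x-block)
        y-tail = proj₂ (∷-injective y-block)
        β-tail = proj₂ (∷-injective b₃≡β)
        same-slice = trans (proj₁ (∷-injective x-block)) (sym (proj₁ (∷-injective y-block)))
        x<β = subst₂ LexLt (sym x-tail) β-tail
                     (lexLt-∷-tail⁻ q c₁ c₃ (blockLt⇒lexLt vb₁ vb₃ b₁<b₃))
        β<y = subst₂ LexLt β-tail (sym y-tail)
                     (lexLt-∷-tail⁻ q c₃ c₂ (blockLt⇒lexLt vb₃ vb₂ b₃<b₂))
    ... | ()

lemma10 : (d : ℕ) (F : Fin d → Factor) (dom : Domination d) →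
          Setup.StandingAssumptions F dom →
          (A : List ℕ → Bool) → Setup.StronglyCompressed F dom A →
          (q : ℕ) (b1 b2 : List ℕ) →
          Setup.IsBlockG F dom b1 → Setup.IsBlockG F dom b2 →
          Setup.InSlice F dom q b1 → Setup.InSlice F dom q b2 →
          Setup.blockLt F dom b1 b2 ≡ true →
          (∃ λ v → v ∈ blockVerts (Setup.FG F dom) b1 × A v ≡ false) →
          (∃ λ v → v ∈ blockVerts (Setup.FG F dom) b2 × A v ≡ true) →
          Setup.Consecutive F dom q b1 b2
lemma10 d F dom SA A compressed q _ _ vb₁ vb₂ (_ , refl) (_ , refl) _ with Setup.StandingAssumptions.d≥3 SA
... | s≤s (s≤s (s≤s _)) = Slice.consecutive F dom starts compressed q vb₁ vb₂
  where
    open Setup.StandingAssumptions SA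
    starts = λ i → partitionStarts (F i) (isoperimetric i) (partition i)
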